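{- Let $N\ge 2$ and identify the space $R^{(N)}$ of homogeneous polynomials of total degree $N$ in $\mathbb{C}[X_1,\ldots,X_N]$ with the subspace $\mathcal{H}=\mathrm{span}\{|n_1\rangle\otimes\cdots\otimes|n_N\rangle : n\in\mathcal{N}^{(N)}\}$ of $(\mathbb{C}^{N+1})^{\otimes N}$ via $X^n\mapsto |n_1\rangle\otimes\cdots\otimes|n_N\rangle$, where $|0\rangle,\ldots,|N\rangle$ is the standard basis of $\mathbb{C}^{N+1}$. (i) If $F\in M_{N\times N}(\mathbb{C})$ equals the identity matrix except that its $(k,k)$ entry is $a\in\mathbb{C}$, then on $\mathcal{H}$ the map $\Phi_F$ coincides with $I^{\otimes(k-1)}\otimes G'_k\otimes I^{\otimes(N-k)}$ for an operator $G'_k$ on $\mathbb{C}^{N+1}$ that is diagonal in the standard basis. (ii) If $1\le k\le N-1$ and $F$ equals the identity matrix except that its principal submatrix on rows and columns $k,k+1$ is $\begin{pmatrix} a&b\\ c&d\end{pmatrix}$, then on $\mathcal{H}$ the map $\Phi_F$ coincides with $I^{\otimes(k-1)}\otimes G_{k,k+1}\otimes I^{\otimes(N-k-1)}$, where $G_{k,k+1}$ is a linear operator acting on tensor factors $k$ and $k+1$ that is block diagonal with respect to the subspaces $\mathcal{S}(m)=\mathrm{span}\{|n'\rangle\otimes|n''\rangle : n'+n''=m\}$.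
   Context: For $M\in M_{N\times N}(\mathbb{C})$, $\Phi_M$ is the $\mathbb{C}$-algebra endomorphism of $\mathbb{C}[X_1,\ldots,X_N]$ with $\Phi_M(X_i)=\sum_j M_{ij}X_j$; it maps $R^{(N)}$ into itself and hence is a linear map on $\mathcal{H}$ under the identification. $\mathcal{N}^{(N)}=\{n\in\mathbb{N}^N:\sum_i n_i=N\}$, $X^n=X_1^{n_1}\cdots X_N^{n_N}$. $I$ denotes the identity on $\mathbb{C}^{N+1}$. -}

module Defs where

open import Level using (Level; _⊔_)
open import Algebra.Bundles using (CommutativeRing)
open import Data.Nat using (ℕ; zero; suc) renaming (_+_ to _+ℕ_)
open import Data.Fin using (Fin; toℕ; _≟_)
open import Data.Fin.Properties using (all?)
open import Data.List using (List; []; _∷_; map; foldr; concatMap; allFin)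
open import Data.Product using (_×_; _,_; proj₁; proj₂)
open import Relation.Nullary using (¬_)
open import Relation.Nullary.Decidable using (⌊_⌋)
open import Relation.Binary.PropositionalEquality using (_≡_)
open import Data.Bool using (Bool; if_then_else_)

-- Everything is developed over an arbitrary commutative ring R
-- (the paper works over ℂ, which the Agda standard library lacks).
module Poly {c ℓ : Level} (R : CommutativeRing c ℓ) where
  open CommutativeRing R public

  A : Set c
  A = Carrier

  -- N × N matrices over R (indices 0-based: Fin N)
  Matrix : ℕ → Set c
  Matrix N = Fin N → Fin N → A

  Monomial : ℕ → Set
  Monomial N = Fin N → ℕ

  deg : ∀ {N} → Monomial N → ℕ
  deg {N} m = foldr _+ℕ_ 0 (map m (allFin N))

  -- A polynomial in ℂ[X_1..X_N] is a finite formal sum of terms c X^n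
  -- (a list of terms; equal monomials are summed by `coeff`).
  Poly : ℕ → Set c
  Poly N = List (A × Monomial N)

  sameMono : ∀ {N} → Monomial N → Monomial N → Bool
  sameMono m m' = ⌊ all? (λ i → Data.Nat._≟_ (m i) (m' i)) ⌋

  coeff : ∀ {N} → Poly N → Monomial N → A
  coeff [] m = 0#
  coeff ((a , m') ∷ p) m = (if sameMono m' m then a else 0#) + coeff p m

  -- p belongs to R^{(N)}: homogeneous of total degree N
  -- (every element of R^{(N)} is represented by such a list)
  data AllTerms {N : ℕ} (P : Monomial N → Set) : Poly N → Set c where
    []  : AllTerms P []
    _∷_ : ∀ {a m p} → P m → AllTerms P p → AllTerms P ((a , m) ∷ p)

  Homogeneous : (N : ℕ) → Poly N → Set c
  Homogeneous N p = AllTerms (λ m → deg m ≡ N) p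

  one : ∀ {N} → Poly N
  one = (1# , (λ _ → 0)) ∷ []

  scale : ∀ {N} → A → Poly N → Poly N
  scale a = map (λ t → (a * proj₁ t , proj₂ t))

  mul : ∀ {N} → Poly N → Poly N → Poly N
  mul p q = concatMap (λ t → map (λ s → (proj₁ t * proj₁ s , λ i → proj₂ t i +ℕ proj₂ s i)) q) p

  pow : ∀ {N} → Poly N → ℕ → Poly N
  pow p zero = one
  pow p (suc e) = mul p (pow p e)

  unitMono : ∀ {N} → Fin N → Monomial N
  unitMono j l = if ⌊ l ≟ j ⌋ then 1 else 0

  linForm : ∀ {N} → Matrix N → Fin N → Poly N
  linForm {N} M i = map (λ j → (M i j , unitMono j)) (allFin N)

  ΦMono : ∀ {N} → Matrix N → Monomial N → Poly N
  ΦMono {N} M n = foldr mul one (map (λ i → pow (linForm M i) (n i)) (allFin N))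

  Φ : ∀ {N} → Matrix N → Poly N → Poly N
  Φ M p = concatMap (λ t → scale (proj₁ t) (ΦMono M (proj₂ t))) p

  -- (C^{N+1})^{⊗N}: coordinates w.r.t. the product basis |f_1⟩⊗⋯⊗|f_N⟩,
  -- f : Fin N → Fin (N+1)
  Tensor : ℕ → Set c
  Tensor N = (Fin N → Fin (suc N)) → A

  ι : ∀ {N} → Poly N → Tensor N
  ι p f = coeff p (λ i → toℕ (f i))

  -- operators on C^{N+1}  (matrix entries ⟨i|G|j⟩)
  Op1 : ℕ → Set c
  Op1 N = Fin (suc N) → Fin (suc N) → A

  -- operators on C^{N+1} ⊗ C^{N+1}:  G i i' j j' = ⟨i,i'|G|j,j'⟩
  Op2 : ℕ → Set c
  Op2 N = Fin (suc N) → Fin (suc N) → Fin (suc N) → Fin (suc N) → A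

  sumFin : ∀ n → (Fin n → A) → A
  sumFin n g = foldr _+_ 0# (map g (allFin n))

  upd : ∀ {N} → (Fin N → Fin (suc N)) → Fin N → Fin (suc N) → (Fin N → Fin (suc N))
  upd f k j l = if ⌊ l ≟ k ⌋ then j else f l

  -- I^{⊗(k-1)} ⊗ G ⊗ I^{⊗(N-k)}  (k is the 0-based tensor position)
  actOne : ∀ {N} → Fin N → Op1 N → Tensor N → Tensor N
  actOne {N} k G v f = sumFin (suc N) (λ j → G (f k) j * v (upd f k j))

  -- I^{⊗(k-1)} ⊗ G_{k,k+1} ⊗ I^{⊗(N-k-1)}, G acting on positions k, k'
  actTwo : ∀ {N} → Fin N → Fin N → Op2 N → Tensor N → Tensor N
  actTwo {N} k k' G v f =
    sumFin (suc N) (λ j → sumFin (suc N) (λ j' →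
      G (f k) (f k') j j' * v (upd (upd f k j) k' j')))

  Diagonal : ∀ {N} → Op1 N → Set ℓ
  Diagonal G = ∀ i j → ¬ (i ≡ j) → G i j ≈ 0#

  BlockDiagonalS : ∀ {N} → Op2 N → Set ℓ
  BlockDiagonalS G = ∀ i i' j j' → ¬ (toℕ i +ℕ toℕ i' ≡ toℕ j +ℕ toℕ j') → G i i' j j' ≈ 0#

  idEntry : ∀ {N} → Fin N → Fin N → A
  idEntry i j = if ⌊ i ≟ j ⌋ then 1# else 0#

  CoincideOnH : ∀ {N} → Matrix N → (Tensor N → Tensor N) → Set (c ⊔ ℓ)
  CoincideOnH {N} F T = ∀ (p : Poly N) → Homogeneous N p →
    ∀ (f : Fin N → Fin (suc N)) → T (ι p) f ≈ ι (Φ F p) f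

module Submission where

-- Let S be a set of indices such that F agrees with the identity outside S × S. Φ_F fixes every
-- variable outside S and maps the span of the variables in S to itself, so Φ_F(X^n) is X^(n off S) times
-- Φ_F(X^(n on S)), a homogeneous polynomial of degree Σ_{i∈S} n_i in the variables of S. Hence the
-- coefficient of X^φ in Φ_F(X^n) vanishes unless n and φ agree off S, and otherwise equals the
-- coefficient of X^(φ on S) in Φ_F(X^(n on S)). Read on the tensor basis, these coefficients are
-- the matrix entries of an operator acting only on the factors in S; degree preservation makes it
-- diagonal when S is one index and block diagonal for the subspaces S(m) when S is two indices.

open import Defs
open import Level using (Level; _⊔_)
open import Algebra.Bundles using (CommutativeRing; CommutativeMonoid)
open import Data.Nat using (ℕ; _≤_; suc)
open import Data.Fin using (Fin; toℕ)
open import Data.Product using (_×_; Σ; _,_)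
open import Data.Sum using (_⊎_)
open import Relation.Nullary using (¬_)
open import Relation.Binary.PropositionalEquality using (_≡_)
import Relation.Binary.PropositionalEquality as ≡
import Data.Nat.Properties as ℕ

module ListSum {a ℓ} (M : CommutativeMonoid a ℓ) where

  open CommutativeMonoid M
  open import Algebra.Properties.CommutativeSemigroup commutativeSemigroup using (interchange)
  open import Data.Fin using (zero; suc)
  open import Data.List using (List; []; _∷_; foldr; map; allFin)
  open import Data.List.Properties using (map-tabulate)
  open import Data.Fin.Properties using (suc-injective)
  open import Function using (id; _∘_)

  ∑ : ∀ {b} {X : Set b} → List X → (X → Carrier) → Carrier
  ∑ xs g = foldr _∙_ ε (map g xs)

  module _ {b} {X : Set b} where

    ∑-cong : ∀ (xs : List X) {g g' : X → Carrier} → (∀ x → g x ≈ g' x) → ∑ xs g ≈ ∑ xs g'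
    ∑-cong []       g≈g' = refl
    ∑-cong (x ∷ xs) g≈g' = ∙-cong (g≈g' x) (∑-cong xs g≈g')

    ∑-ε : ∀ (xs : List X) {g : X → Carrier} → (∀ x → g x ≈ ε) → ∑ xs g ≈ ε
    ∑-ε []       g≈ε = refl
    ∑-ε (x ∷ xs) g≈ε = trans (∙-cong (g≈ε x) (∑-ε xs g≈ε)) (identityˡ ε)

    ∑-∙ : ∀ (xs : List X) (g g' : X → Carrier) → ∑ xs (λ x → g x ∙ g' x) ≈ ∑ xs g ∙ ∑ xs g'
    ∑-∙ []       g g' = sym (identityˡ ε)
    ∑-∙ (x ∷ xs) g g' = trans (∙-cong refl (∑-∙ xs g g')) (interchange _ _ _ _)

  ∑-allFin-suc : ∀ {n} (g : Fin (suc n) → Carrier) → ∑ (allFin (suc n)) g ≈ g zero ∙ ∑ (allFin n) (g ∘ suc)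
  ∑-allFin-suc g = reflexive (≡.cong (λ xs → g zero ∙ foldr _∙_ ε xs)
    (≡.trans (map-tabulate suc g) (≡.sym (map-tabulate id (g ∘ suc)))))

  ∑-unique : ∀ {n} (g : Fin n → Carrier) (k : Fin n) → (∀ i → ¬ i ≡ k → g i ≈ ε) → ∑ (allFin n) g ≈ g k
  ∑-unique {suc n} g zero    g≈ε = trans (∑-allFin-suc g)
    (trans (∙-cong refl (∑-ε (allFin n) (λ i → g≈ε (suc i) (λ ())))) (identityʳ _))
  ∑-unique {suc n} g (suc k) g≈ε = trans (∑-allFin-suc g)
    (trans (∙-cong (g≈ε zero (λ ())) (∑-unique (g ∘ suc) k (λ i i≢k → g≈ε (suc i) (i≢k ∘ suc-injective))))
           (identityˡ _))

module Development {c ℓ : Level} (R : CommutativeRing c ℓ) where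

  open Poly R
  open import Data.Nat using (zero; s≤s) renaming (_+_ to _+ℕ_; _*_ to _*ℕ_; _≟_ to _≟ℕ_)
  open import Algebra.Properties.CommutativeSemigroup ℕ.+-commutativeSemigroup
    using () renaming (interchange to ℕ-interchange)
  open import Data.Fin using (_≟_; fromℕ<)
  open import Data.Fin.Properties using (all?; toℕ-injective; toℕ-fromℕ<)
  open import Data.List using (List; []; _∷_; map; foldr; allFin; _++_)
  open import Data.List.Properties using (map-cong)
  open import Data.List.Membership.Propositional using (_∈_)
  open import Data.List.Membership.Propositional.Properties using (∈-allFin)
  open import Data.List.Relation.Unary.Any using (here; there)
  open import Data.Product using (proj₁; proj₂)
  open import Data.Sum using (inj₁; inj₂)
  open import Data.Bool using (if_then_else_)
  open import Data.Empty using (⊥-elim)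
  open import Function using (_∘_; _⇔_; mk⇔; Equivalence)
  open import Relation.Nullary using (Dec; yes; no; ¬?)
  open import Relation.Nullary.Decidable using (⌊_⌋; _→-dec_; _⊎-dec_)
  open import Relation.Unary using (Decidable)
  open ≡ using (_≗_)
  open import Relation.Binary.Reasoning.Setoid setoid
  open import Algebra.Properties.CommutativeSemigroup +-commutativeSemigroup
    using () renaming (interchange to +-interchange)
  open import Algebra.Properties.CommutativeSemigroup *-commutativeSemigroup
    using () renaming (x∙yz≈y∙xz to x*[y*z]≈y*[x*z])

  open ListSum +-commutativeMonoid using (∑; ∑-cong; ∑-unique)
  module ∑ℕ = ListSum ℕ.+-0-commutativeMonoid

  -- Monomials as exponent vectors

  infixl 6 _⊕_
  infixr 7 _×ₘ_

  1ₘ : ∀ {N} → Monomial N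
  1ₘ _ = 0

  _⊕_ : ∀ {N} → Monomial N → Monomial N → Monomial N
  (u ⊕ v) i = u i +ℕ v i

  _×ₘ_ : ∀ {N} → ℕ → Monomial N → Monomial N
  (e ×ₘ u) i = e *ℕ u i

  X[_]^_ : ∀ {N} → Fin N → ℕ → Monomial N
  X[ k ]^ x = x ×ₘ unitMono k

  unitMono-≡ : ∀ {N} (k : Fin N) → unitMono k k ≡ 1
  unitMono-≡ k with k ≟ k
  ... | yes _   = ≡.refl
  ... | no k≢k = ⊥-elim (k≢k ≡.refl)

  unitMono-≢ : ∀ {N} {i k : Fin N} → ¬ i ≡ k → unitMono k i ≡ 0
  unitMono-≢ {i = i} {k} i≢k with i ≟ k
  ... | yes i≡k = ⊥-elim (i≢k i≡k)
  ... | no _    = ≡.refl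

  X^-≡ : ∀ {N} (k : Fin N) x → (X[ k ]^ x) k ≡ x
  X^-≡ k x = ≡.trans (≡.cong (x *ℕ_) (unitMono-≡ k)) (ℕ.*-identityʳ x)

  X^-≢ : ∀ {N} {i k : Fin N} x → ¬ i ≡ k → (X[ k ]^ x) i ≡ 0
  X^-≢ x i≢k = ≡.trans (≡.cong (x *ℕ_) (unitMono-≢ i≢k)) (ℕ.*-zeroʳ x)

  ∏ₘ : ∀ {N b} {X : Set b} → List X → (X → Monomial N) → Monomial N
  ∏ₘ xs g = foldr _⊕_ 1ₘ (map g xs)

  ∏ₘ-apply : ∀ {N b} {X : Set b} (xs : List X) (g : X → Monomial N) l → ∏ₘ xs g l ≡ ∑ℕ.∑ xs (λ x → g x l)
  ∏ₘ-apply []       g l = ≡.refl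
  ∏ₘ-apply (x ∷ xs) g l = ≡.cong (g x l +ℕ_) (∏ₘ-apply xs g l)

  monomial-expansion : ∀ {N} (e : Monomial N) → ∏ₘ (allFin N) (λ i → X[ i ]^ e i) ≗ e
  monomial-expansion {N} e l = ≡.trans (∏ₘ-apply (allFin N) (λ i → X[ i ]^ e i) l)
    (≡.trans (∑ℕ.∑-unique (λ i → (X[ i ]^ e i) l) l (λ i i≢l → X^-≢ (e i) (i≢l ∘ ≡.sym))) (X^-≡ l (e l)))

  deg-cong : ∀ {N} {u v : Monomial N} → u ≗ v → deg u ≡ deg v
  deg-cong {N} u≗v = ∑ℕ.∑-cong (allFin N) u≗v

  deg-1ₘ : ∀ {N} → deg {N} 1ₘ ≡ 0
  deg-1ₘ {N} = ∑ℕ.∑-ε (allFin N) (λ _ → ≡.refl)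

  deg-⊕ : ∀ {N} (u v : Monomial N) → deg (u ⊕ v) ≡ deg u +ℕ deg v
  deg-⊕ {N} u v = ∑ℕ.∑-∙ (allFin N) u v

  deg-×ₘ : ∀ {N} e (u : Monomial N) → deg (e ×ₘ u) ≡ e *ℕ deg u
  deg-×ₘ {N} zero u = deg-1ₘ {N}
  deg-×ₘ {N} (suc e) u = ≡.trans (deg-⊕ u (e ×ₘ u)) (≡.cong (deg u +ℕ_) (deg-×ₘ e u))

  deg-unitMono : ∀ {N} (k : Fin N) → deg (unitMono k) ≡ 1
  deg-unitMono k = ≡.trans (∑ℕ.∑-unique (unitMono k) k (λ i → unitMono-≢)) (unitMono-≡ k)

  deg-X^ : ∀ {N} (k : Fin N) x → deg (X[ k ]^ x) ≡ x
  deg-X^ k x = ≡.trans (deg-×ₘ x (unitMono k)) (≡.trans (≡.cong (x *ℕ_) (deg-unitMono k)) (ℕ.*-identityʳ x))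

  exponent≤deg : ∀ {N} (n : Monomial N) i → n i ≤ deg n
  exponent≤deg {N} n i = go (allFin N) (∈-allFin i)
    where
      go : ∀ xs → i ∈ xs → n i ≤ ∑ℕ.∑ xs n
      go (x ∷ xs) (here ≡.refl) = ℕ.m≤m+n (n i) _
      go (x ∷ xs) (there i∈xs)  = ℕ.≤-trans (go xs i∈xs) (ℕ.m≤n+m _ (n x))

  𝟙 : ∀ {p} {P : Set p} → Dec P → A
  𝟙 d = if ⌊ d ⌋ then 1# else 0#

  module _ {p} {P : Set p} where

    𝟙-yes : P → (d : Dec P) → 𝟙 d ≈ 1#
    𝟙-yes _ (yes _) = refl
    𝟙-yes x (no ¬x) = ⊥-elim (¬x x)

    𝟙-no : ¬ P → (d : Dec P) → 𝟙 d ≈ 0#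
    𝟙-no ¬x (yes x) = ⊥-elim (¬x x)
    𝟙-no _  (no _)  = refl

    if-then-0 : (d : Dec P) (a : A) → (if ⌊ d ⌋ then a else 0#) ≈ a * 𝟙 d
    if-then-0 (yes _) a = sym (*-identityʳ a)
    if-then-0 (no _)  a = sym (zeroʳ a)

    𝟙-cong : ∀ {q} {Q : Set q} → P ⇔ Q → (d : Dec P) (d' : Dec Q) → 𝟙 d ≈ 𝟙 d'
    𝟙-cong P⇔Q d (yes y) = 𝟙-yes (Equivalence.from P⇔Q y) d
    𝟙-cong P⇔Q d (no ¬y) = 𝟙-no (¬y ∘ Equivalence.to P⇔Q) d

    𝟙-× : ∀ {q q'} {Q : Set q} {Q' : Set q'} → P ⇔ (Q × Q') →
      (d : Dec P) (d₁ : Dec Q) (d₂ : Dec Q') → 𝟙 d ≈ 𝟙 d₁ * 𝟙 d₂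
    𝟙-× P⇔Q×Q' d (yes y) (yes y') = trans (𝟙-yes (Equivalence.from P⇔Q×Q' (y , y')) d) (sym (*-identityˡ 1#))
    𝟙-× P⇔Q×Q' d (no ¬y) d₂       = trans (𝟙-no (¬y ∘ proj₁ ∘ Equivalence.to P⇔Q×Q') d) (sym (zeroˡ _))
    𝟙-× P⇔Q×Q' d (yes _) (no ¬y') = trans (𝟙-no (¬y' ∘ proj₂ ∘ Equivalence.to P⇔Q×Q') d) (sym (zeroʳ _))

  _≟ₘ_ : ∀ {N} (u v : Monomial N) → Dec (u ≗ v)
  u ≟ₘ v = all? (λ i → u i ≟ℕ v i)

  δ : ∀ {N} → Monomial N → Monomial N → A
  δ m u = 𝟙 (u ≟ₘ m)

  Respects≗ : ∀ {N} → (Monomial N → A) → Set ℓ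
  Respects≗ h = ∀ {u v} → u ≗ v → h u ≈ h v

  δ-respects : ∀ {N} (m : Monomial N) → Respects≗ (δ m)
  δ-respects m {u} {v} u≗v = 𝟙-cong (mk⇔ (λ u≗m i → ≡.trans (≡.sym (u≗v i)) (u≗m i))
                                          (λ v≗m i → ≡.trans (u≗v i) (v≗m i))) (u ≟ₘ m) (v ≟ₘ m)

  δ-cong : ∀ {N} {m m' : Monomial N} → m ≗ m' → ∀ u → δ m u ≈ δ m' u
  δ-cong {m = m} {m'} m≗m' u = 𝟙-cong (mk⇔ (λ u≗m i → ≡.trans (u≗m i) (m≗m' i))
                                            (λ u≗m' i → ≡.trans (u≗m' i) (≡.sym (m≗m' i)))) (u ≟ₘ m) (u ≟ₘ m')

  -- Polynomials through their pairings with functions on monomials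

  pairing : ∀ {N} → Poly N → (Monomial N → A) → A
  pairing []            h = 0#
  pairing ((a , m) ∷ p) h = a * h m + pairing p h

  pairing-cong : ∀ {N} (p : Poly N) {h h' : Monomial N → A} → (∀ u → h u ≈ h' u) → pairing p h ≈ pairing p h'
  pairing-cong []            h≈h' = refl
  pairing-cong ((a , m) ∷ p) h≈h' = +-cong (*-cong refl (h≈h' m)) (pairing-cong p h≈h')

  pairing-congᴬ : ∀ {N} {S : Monomial N → Set} {p : Poly N} {h h' : Monomial N → A} →
    AllTerms S p → (∀ u → S u → h u ≈ h' u) → pairing p h ≈ pairing p h'
  pairing-congᴬ []         h≈h' = refl
  pairing-congᴬ (s ∷ all) h≈h' = +-cong (*-cong refl (h≈h' _ s)) (pairing-congᴬ all h≈h')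

  pairing-++ : ∀ {N} (p q : Poly N) h → pairing (p ++ q) h ≈ pairing p h + pairing q h
  pairing-++ []            q h = sym (+-identityˡ _)
  pairing-++ ((a , m) ∷ p) q h = trans (+-cong refl (pairing-++ p q h)) (sym (+-assoc _ _ _))

  pairing-0 : ∀ {N} (p : Poly N) → pairing p (λ _ → 0#) ≈ 0#
  pairing-0 []            = refl
  pairing-0 ((a , m) ∷ p) = trans (+-cong (zeroʳ a) (pairing-0 p)) (+-identityˡ 0#)

  pairing-+ : ∀ {N} (p : Poly N) h h' → pairing p (λ u → h u + h' u) ≈ pairing p h + pairing p h'
  pairing-+ []            h h' = sym (+-identityˡ 0#)
  pairing-+ ((a , m) ∷ p) h h' =
    trans (+-cong (distribˡ a (h m) (h' m)) (pairing-+ p h h')) (+-interchange _ _ _ _)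

  pairing-*ˡ : ∀ {N} (p : Poly N) x h → pairing p (λ u → x * h u) ≈ x * pairing p h
  pairing-*ˡ []            x h = sym (zeroʳ x)
  pairing-*ˡ ((a , m) ∷ p) x h =
    trans (+-cong (x*[y*z]≈y*[x*z] a x (h m)) (pairing-*ˡ p x h)) (sym (distribˡ x _ _))

  pairing-∑ : ∀ {N b} {X : Set b} (p : Poly N) (xs : List X) (g : X → Monomial N → A) →
    pairing p (λ n → ∑ xs (λ x → g x n)) ≈ ∑ xs (λ x → pairing p (g x))
  pairing-∑ p []       g = pairing-0 p
  pairing-∑ p (x ∷ xs) g = trans (pairing-+ p (g x) _) (+-cong refl (pairing-∑ p xs g))

  pairing-term-mul : ∀ {N} a (m : Monomial N) (q : Poly N) h →
    pairing (map (λ s → (a * proj₁ s , λ i → m i +ℕ proj₂ s i)) q) h ≈ a * pairing q (λ v → h (m ⊕ v))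
  pairing-term-mul a m []            h = sym (zeroʳ a)
  pairing-term-mul a m ((b , v) ∷ q) h =
    trans (+-cong (*-assoc a b _) (pairing-term-mul a m q h)) (sym (distribˡ a _ _))

  pairing-mul : ∀ {N} (p q : Poly N) h → pairing (mul p q) h ≈ pairing p (λ u → pairing q (λ v → h (u ⊕ v)))
  pairing-mul []            q h = refl
  pairing-mul ((a , m) ∷ p) q h =
    trans (pairing-++ (map _ q) (mul p q) h) (+-cong (pairing-term-mul a m q h) (pairing-mul p q h))

  -- Up to η, scale a is multiplication by the term a · X^0.
  pairing-scale : ∀ {N} a (p : Poly N) h → pairing (scale a p) h ≈ a * pairing p h
  pairing-scale {N} a = pairing-term-mul a (1ₘ {N})

  pairing-Φ : ∀ {N} (M : Matrix N) (p : Poly N) h → pairing (Φ M p) h ≈ pairing p (λ m → pairing (ΦMono M m) h)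
  pairing-Φ M []            h = refl
  pairing-Φ M ((a , m) ∷ p) h = trans (pairing-++ (scale a (ΦMono M m)) (Φ M p) h)
    (+-cong (pairing-scale a (ΦMono M m) h) (pairing-Φ M p h))

  coeff-pairing : ∀ {N} (p : Poly N) m → coeff p m ≈ pairing p (δ m)
  coeff-pairing []             m = refl
  coeff-pairing ((a , m') ∷ p) m = +-cong (if-then-0 (m' ≟ₘ m) a) (coeff-pairing p m)

  idEntry-≡ : ∀ {N} (i : Fin N) → idEntry i i ≈ 1#
  idEntry-≡ i with i ≟ i
  ... | yes _   = refl
  ... | no i≢i = ⊥-elim (i≢i ≡.refl)

  idEntry-≢ : ∀ {N} {i j : Fin N} → ¬ i ≡ j → idEntry i j ≈ 0#
  idEntry-≢ {i = i} {j} i≢j with i ≟ j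
  ... | yes i≡j = ⊥-elim (i≢j i≡j)
  ... | no _    = refl

  pairing-linForm : ∀ {N} (M : Matrix N) i h → pairing (linForm M i) h ≈ ∑ (allFin N) (λ j → M i j * h (unitMono j))
  pairing-linForm {N} M i h = reflexive (go (allFin N))
    where
      go : ∀ xs → pairing (map (λ j → (M i j , unitMono j)) xs) h ≡ ∑ xs (λ j → M i j * h (unitMono j))
      go []       = ≡.refl
      go (j ∷ xs) = ≡.cong (M i j * h (unitMono j) +_) (go xs)

  ∏ᴾ : ∀ {N b} {X : Set b} → List X → (X → Poly N) → Poly N
  ∏ᴾ xs P = foldr mul one (map P xs)

  -- Pairing against δ m reads off the coefficient of X^m, so Factors P Q r says P = Q · X^r and
  -- Supported S P says that every monomial occurring in P satisfies S.
  Factors : ∀ {N} → Poly N → Poly N → Monomial N → Set (c ⊔ ℓ)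
  Factors P Q r = ∀ h → Respects≗ h → pairing P h ≈ pairing Q (λ u → h (u ⊕ r))

  Factors-refl : ∀ {N} (P : Poly N) → Factors P P 1ₘ
  Factors-refl P h h-resp = pairing-cong P (λ u → h-resp (λ i → ≡.sym (ℕ.+-identityʳ (u i))))

  Factors-cong : ∀ {N} {P Q : Poly N} {r r'} → r ≗ r' → Factors P Q r → Factors P Q r'
  Factors-cong {Q = Q} r≗r' P≈Qr h h-resp =
    trans (P≈Qr h h-resp) (pairing-cong Q (λ u → h-resp (λ i → ≡.cong (u i +ℕ_) (r≗r' i))))

  Factors-mul : ∀ {N} {P Q P' Q' : Poly N} {r r'} → Factors P Q r → Factors P' Q' r' →
    Factors (mul P P') (mul Q Q') (r ⊕ r')
  Factors-mul {P = P} {Q} {P'} {Q'} {r} {r'} P≈Qr P'≈Q'r' h h-resp = begin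
    pairing (mul P P') h
      ≈⟨ pairing-mul P P' h ⟩
    pairing P (λ u → pairing P' (λ v → h (u ⊕ v)))
      ≈⟨ pairing-cong P (λ u → P'≈Q'r' _ (λ v≗v' → h-resp (λ i → ≡.cong (u i +ℕ_) (v≗v' i)))) ⟩
    pairing P (λ u → pairing Q' (λ v → h (u ⊕ (v ⊕ r'))))
      ≈⟨ P≈Qr _ (λ u≗u' → pairing-cong Q' (λ v → h-resp (λ i → ≡.cong (_+ℕ (v i +ℕ r' i)) (u≗u' i)))) ⟩
    pairing Q (λ u → pairing Q' (λ v → h ((u ⊕ r) ⊕ (v ⊕ r'))))
      ≈⟨ pairing-cong Q (λ u → pairing-cong Q' (λ v → h-resp (λ i → ℕ-interchange (u i) (r i) (v i) (r' i)))) ⟩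
    pairing Q (λ u → pairing Q' (λ v → h ((u ⊕ v) ⊕ (r ⊕ r'))))
      ≈⟨ pairing-mul Q Q' _ ⟨
    pairing (mul Q Q') (λ w → h (w ⊕ (r ⊕ r'))) ∎

  Factors-∏ : ∀ {N b} {X : Set b} (xs : List X) {P Q : X → Poly N} {r : X → Monomial N} →
    (∀ x → Factors (P x) (Q x) (r x)) → Factors (∏ᴾ xs P) (∏ᴾ xs Q) (∏ₘ xs r)
  Factors-∏ []       _        h _ = refl
  Factors-∏ (x ∷ xs) {P} {Q} P≈Qr =
    Factors-mul {P = P x} {Q x} {∏ᴾ xs P} {∏ᴾ xs Q} (P≈Qr x) (Factors-∏ xs P≈Qr)

  Factors-pow : ∀ {N} {P : Poly N} {r} → Factors P one r → ∀ e → Factors (pow P e) one (e ×ₘ r)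
  Factors-pow P≈r zero    h _      = refl
  Factors-pow {P = P} P≈r (suc e) h h-resp =
    trans (Factors-mul {P = P} {one} {pow P e} {one} P≈r (Factors-pow P≈r e) h h-resp)
          (+-cong (*-cong (*-identityˡ 1#) refl) refl)   -- mul one one is the single term (1# * 1#) · X^0

  Supported : ∀ {N} → (Monomial N → Set) → Poly N → Set (c ⊔ ℓ)
  Supported S P = ∀ h h' → (∀ u → S u → h u ≈ h' u) → pairing P h ≈ pairing P h'

  Supported-one : ∀ {N} {S : Monomial N → Set} → S 1ₘ → Supported S one
  Supported-one S1 h h' h≈h' = +-cong (*-cong refl (h≈h' 1ₘ S1)) refl

  Supported-mul : ∀ {N} {S T U : Monomial N → Set} {P Q : Poly N} →
    (∀ {u v} → S u → T v → U (u ⊕ v)) → Supported S P → Supported T Q → Supported U (mul P Q)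
  Supported-mul {P = P} {Q} S⊕T⇒U P-supp Q-supp h h' h≈h' = begin
    pairing (mul P Q) h
      ≈⟨ pairing-mul P Q h ⟩
    pairing P (λ u → pairing Q (λ v → h (u ⊕ v)))
      ≈⟨ P-supp _ _ (λ u Su → Q-supp _ _ (λ v Tv → h≈h' _ (S⊕T⇒U Su Tv))) ⟩
    pairing P (λ u → pairing Q (λ v → h' (u ⊕ v)))
      ≈⟨ pairing-mul P Q h' ⟨
    pairing (mul P Q) h' ∎

  module Graded {N} (Q : ℕ → Monomial N → Set) (Q-1ₘ : Q 0 1ₘ)
                (Q-⊕ : ∀ {d e u v} → Q d u → Q e v → Q (d +ℕ e) (u ⊕ v)) where

    Supported-pow : ∀ {P : Poly N} → Supported (Q 1) P → ∀ e → Supported (Q e) (pow P e)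
    Supported-pow P-supp zero    = Supported-one Q-1ₘ
    Supported-pow {P} P-supp (suc e) = Supported-mul {P = P} {pow P e} Q-⊕ P-supp (Supported-pow P-supp e)

    Supported-∏ : ∀ {b} {X : Set b} (xs : List X) {P : X → Poly N} {g : X → ℕ} →
      (∀ x → Supported (Q (g x)) (P x)) → Supported (Q (∑ℕ.∑ xs g)) (∏ᴾ xs P)
    Supported-∏ []       _      = Supported-one Q-1ₘ
    Supported-∏ (x ∷ xs) {P} P-supp = Supported-mul {P = P x} {∏ᴾ xs P} Q-⊕ (P-supp x) (Supported-∏ xs P-supp)

  Φcoeff : ∀ {N} → Matrix N → Monomial N → Monomial N → A
  Φcoeff M n φ = pairing (ΦMono M n) (δ φ)

  ΦMono-cong : ∀ {N} (M : Matrix N) {n n' : Monomial N} → n ≗ n' → ΦMono M n ≡ ΦMono M n'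
  ΦMono-cong {N} M n≗n' = ≡.cong (foldr mul one) (map-cong (λ i → ≡.cong (pow (linForm M i)) (n≗n' i)) (allFin N))

  -- Substitutions that are the identity outside S × S

  module Local {N} (F : Matrix N) {S : Fin N → Set} (S? : Decidable S)
               (F-local : ∀ i j → ¬ (S i × S j) → F i j ≈ idEntry i j) where

    VanishesOff : Monomial N → Set
    VanishesOff u = ∀ i → ¬ S i → u i ≡ 0

    AgreeOff : Monomial N → Monomial N → Set
    AgreeOff u v = ∀ i → ¬ S i → u i ≡ v i

    agreeOff? : ∀ u v → Dec (AgreeOff u v)
    agreeOff? u v = all? (λ i → ¬? (S? i) →-dec (u i ≟ℕ v i))

    restrict rest : Monomial N → Monomial N
    restrict n i = if ⌊ S? i ⌋ then n i else 0
    rest     n i = if ⌊ S? i ⌋ then 0 else n i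

    module _ {n : Monomial N} {i : Fin N} where

      restrict-out : ¬ S i → restrict n i ≡ 0
      restrict-out ¬s with S? i
      ... | yes s = ⊥-elim (¬s s)
      ... | no _  = ≡.refl

      rest-out : ¬ S i → rest n i ≡ n i
      rest-out ¬s with S? i
      ... | yes s = ⊥-elim (¬s s)
      ... | no _  = ≡.refl

    restrict-vanishesOff : ∀ n → VanishesOff (restrict n)
    restrict-vanishesOff n i = restrict-out {n}

    restrict-unique : ∀ {m n} → VanishesOff m → (∀ i → S i → m i ≡ n i) → m ≗ restrict n
    restrict-unique m-van m≡n i with S? i
    ... | yes s  = m≡n i s
    ... | no ¬s = m-van i ¬s

    OnS : ℕ → Monomial N → Set
    OnS d u = VanishesOff u × deg u ≡ d

    OnS-1ₘ : OnS 0 1ₘ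
    OnS-1ₘ = (λ _ _ → ≡.refl) , deg-1ₘ {N}

    OnS-⊕ : ∀ {d e u v} → OnS d u → OnS e v → OnS (d +ℕ e) (u ⊕ v)
    OnS-⊕ {u = u} {v} (u-van , deg-u) (v-van , deg-v) =
      (λ i ¬s → ≡.cong₂ _+ℕ_ (u-van i ¬s) (v-van i ¬s)) , ≡.trans (deg-⊕ u v) (≡.cong₂ _+ℕ_ deg-u deg-v)

    open Graded OnS OnS-1ₘ OnS-⊕

    row-outside : ∀ {i} → ¬ S i → Factors (linForm F i) one (unitMono i)
    row-outside {i} ¬s h h-resp = begin
      pairing (linForm F i) h
        ≈⟨ pairing-linForm F i h ⟩
      ∑ (allFin N) (λ j → F i j * h (unitMono j))
        ≈⟨ ∑-unique _ i (λ j j≢i → trans (*-cong (F-off j j≢i) refl) (zeroˡ _)) ⟩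
      F i i * h (unitMono i)
        ≈⟨ *-cong (trans (F-local i i (¬s ∘ proj₁)) (idEntry-≡ i)) refl ⟩
      1# * h (unitMono i)
        ≈⟨ +-identityʳ _ ⟨
      1# * h (unitMono i) + 0# ∎
      where
        F-off : ∀ j → ¬ j ≡ i → F i j ≈ 0#
        F-off j j≢i = trans (F-local i j (¬s ∘ proj₁)) (idEntry-≢ (j≢i ∘ ≡.sym))

    row-inside-supported : ∀ {i} → S i → Supported (OnS 1) (linForm F i)
    row-inside-supported {i} s h h' h≈h' =
      trans (pairing-linForm F i h) (trans (∑-cong (allFin N) term) (sym (pairing-linForm F i h')))
      where
        term : ∀ j → F i j * h (unitMono j) ≈ F i j * h' (unitMono j)
        term j with S? j
        ... | yes sj  = *-cong refl (h≈h' _ (unit-vanishesOff , deg-unitMono j))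
          where
            unit-vanishesOff : VanishesOff (unitMono j)
            unit-vanishesOff l ¬sl = unitMono-≢ (λ l≡j → ¬sl (≡.subst S (≡.sym l≡j) sj))
        ... | no ¬sj = trans (*-cong Fij≈0 refl) (trans (zeroˡ _) (sym (trans (*-cong Fij≈0 refl) (zeroˡ _))))
          where
            Fij≈0 : F i j ≈ 0#
            Fij≈0 = trans (F-local i j (¬sj ∘ proj₂)) (idEntry-≢ (λ i≡j → ¬sj (≡.subst S i≡j s)))

    ΦMono-supported : ∀ {n} → VanishesOff n → Supported (OnS (deg n)) (ΦMono F n)
    ΦMono-supported {n} n-van = Supported-∏ (allFin N) factor
      where
        factor : ∀ i → Supported (OnS (n i)) (pow (linForm F i) (n i))
        factor i with S? i
        ... | yes s  = Supported-pow (row-inside-supported s) (n i)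
        ... | no ¬s = ≡.subst (λ e → Supported (OnS e) (pow (linForm F i) e)) (≡.sym (n-van i ¬s)) (Supported-one OnS-1ₘ)

    ΦMono-factors : ∀ n → Factors (ΦMono F n) (ΦMono F (restrict n)) (rest n)
    ΦMono-factors n = Factors-cong {P = ΦMono F n} {ΦMono F (restrict n)} (monomial-expansion (rest n))
      (Factors-∏ (allFin N) {λ i → pow (linForm F i) (n i)} {λ i → pow (linForm F i) (restrict n i)} factor)
      where
        factor : ∀ i → Factors (pow (linForm F i) (n i)) (pow (linForm F i) (restrict n i)) (X[ i ]^ rest n i)
        factor i with S? i
        ... | yes _  = Factors-refl (pow (linForm F i) (n i))
        ... | no ¬s = Factors-pow (row-outside ¬s) (n i)

    ⊕rest≗⇔ : ∀ {u n φ} → VanishesOff u → (u ⊕ rest n ≗ φ) ⇔ (AgreeOff n φ × u ≗ restrict φ)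
    ⊕rest≗⇔ {u} {n} {φ} u-van = mk⇔ split join
      where
        split : u ⊕ rest n ≗ φ → AgreeOff n φ × u ≗ restrict φ
        split eq = agree , u≗
          where
            agree : AgreeOff n φ
            agree i ¬s = ≡.trans (≡.sym (≡.cong₂ _+ℕ_ (u-van i ¬s) (rest-out {n} ¬s))) (eq i)
            u≗ : u ≗ restrict φ
            u≗ i with S? i | eq i
            ... | yes _  | eqᵢ = ≡.trans (≡.sym (ℕ.+-identityʳ (u i))) eqᵢ
            ... | no ¬s | _   = u-van i ¬s
        join : AgreeOff n φ × u ≗ restrict φ → u ⊕ rest n ≗ φ
        join (agree , u≗) i with S? i | u≗ i
        ... | yes _  | uᵢ≡φᵢ = ≡.trans (ℕ.+-identityʳ (u i)) uᵢ≡φᵢ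
        ... | no ¬s | uᵢ≡0  = ≡.trans (≡.cong (_+ℕ n i) uᵢ≡0) (agree i ¬s)

    Φcoeff-local : ∀ n φ → Φcoeff F n φ ≈ 𝟙 (agreeOff? n φ) * Φcoeff F (restrict n) (restrict φ)
    Φcoeff-local n φ = begin
      pairing (ΦMono F n) (δ φ)
        ≈⟨ ΦMono-factors n (δ φ) (δ-respects φ) ⟩
      pairing (ΦMono F (restrict n)) (λ u → δ φ (u ⊕ rest n))
        ≈⟨ ΦMono-supported (restrict-vanishesOff n) _ _ (λ u (u-van , _) →
             𝟙-× (⊕rest≗⇔ u-van) ((u ⊕ rest n) ≟ₘ φ) (agreeOff? n φ) (u ≟ₘ restrict φ)) ⟩
      pairing (ΦMono F (restrict n)) (λ u → 𝟙 (agreeOff? n φ) * δ (restrict φ) u)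
        ≈⟨ pairing-*ˡ (ΦMono F (restrict n)) _ _ ⟩
      𝟙 (agreeOff? n φ) * pairing (ΦMono F (restrict n)) (δ (restrict φ)) ∎

    Φcoeff-local′ : ∀ {n φ m e ψ} → m ≗ restrict n → e ≗ restrict φ →
      (∀ i → S i → ψ i ≡ n i) → (∀ i → ¬ S i → ψ i ≡ φ i) →
      Φcoeff F m e * δ ψ n ≈ Φcoeff F n φ
    Φcoeff-local′ {n} {φ} {m} {e} {ψ} m≗ e≗ ψ-in ψ-out = begin
      Φcoeff F m e * δ ψ n
        ≈⟨ *-cong (reflexive (≡.cong (λ P → pairing P (δ e)) (ΦMono-cong F m≗)))
                  (𝟙-cong n≗ψ⇔agree (n ≟ₘ ψ) (agreeOff? n φ)) ⟩
      pairing (ΦMono F (restrict n)) (δ e) * 𝟙 (agreeOff? n φ)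
        ≈⟨ *-comm _ _ ⟩
      𝟙 (agreeOff? n φ) * pairing (ΦMono F (restrict n)) (δ e)
        ≈⟨ *-cong refl (pairing-cong (ΦMono F (restrict n)) (δ-cong e≗)) ⟩
      𝟙 (agreeOff? n φ) * Φcoeff F (restrict n) (restrict φ)
        ≈⟨ Φcoeff-local n φ ⟨
      Φcoeff F n φ ∎
      where
        n≗ψ⇔agree : n ≗ ψ ⇔ AgreeOff n φ
        n≗ψ⇔agree = mk⇔ (λ n≗ψ i ¬s → ≡.trans (n≗ψ i) (ψ-out i ¬s)) λ agree i → case i agree
          where
            case : ∀ i → AgreeOff n φ → n i ≡ ψ i
            case i agree with S? i
            ... | yes s  = ≡.sym (ψ-in i s)
            ... | no ¬s = ≡.trans (agree i ¬s) (≡.sym (ψ-out i ¬s))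

    Φcoeff-deg : ∀ {m e} → VanishesOff m → ¬ deg e ≡ deg m → Φcoeff F m e ≈ 0#
    Φcoeff-deg {m} {e} m-van degs≢ = trans
      (ΦMono-supported m-van (δ e) (λ _ → 0#) (λ u (_ , deg-u) →
        𝟙-no (λ u≗e → degs≢ (≡.trans (≡.sym (deg-cong u≗e)) deg-u)) (u ≟ₘ e)))
      (pairing-0 (ΦMono F m))

  -- The operators on the tensor product

  monomialOf : ∀ {N} → (Fin N → Fin (suc N)) → Monomial N
  monomialOf f i = toℕ (f i)

  upd-≡ : ∀ {N} (f : Fin N → Fin (suc N)) k j → upd f k j k ≡ j
  upd-≡ f k j with k ≟ k
  ... | yes _   = ≡.refl
  ... | no k≢k = ⊥-elim (k≢k ≡.refl)

  upd-≢ : ∀ {N} (f : Fin N → Fin (suc N)) {k l} j → ¬ l ≡ k → upd f k j l ≡ f l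
  upd-≢ f {k} {l} j l≢k with l ≟ k
  ... | yes l≡k = ⊥-elim (l≢k l≡k)
  ... | no _    = ≡.refl

  exponentIndex : ∀ {N} (n : Monomial N) → deg n ≡ N → Fin N → Fin (suc N)
  exponentIndex n deg≡N i = fromℕ< (s≤s (≡.subst (n i ≤_) deg≡N (exponent≤deg n i)))

  toℕ-exponentIndex : ∀ {N} (n : Monomial N) deg≡N i → toℕ (exponentIndex n deg≡N i) ≡ n i
  toℕ-exponentIndex n deg≡N i = toℕ-fromℕ< _

  ∑-coeff : ∀ {N b} {X : Set b} (xs : List X) (w : X → A) (m : X → Monomial N) (p : Poly N) →
    ∑ xs (λ x → w x * coeff p (m x)) ≈ pairing p (λ n → ∑ xs (λ x → w x * δ (m x) n))
  ∑-coeff xs w m p = trans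
    (∑-cong xs (λ x → trans (*-cong refl (coeff-pairing p (m x))) (sym (pairing-*ˡ p (w x) (δ (m x))))))
    (sym (pairing-∑ p xs (λ x n → w x * δ (m x) n)))

  ∑-δ-collapse : ∀ {N} {ψ : Fin (suc N) → Monomial N} {k : Fin N} → (∀ j → ψ j k ≡ toℕ j) →
    ∀ {n j} → toℕ j ≡ n k → (g : Fin (suc N) → A) →
    ∑ (allFin (suc N)) (λ j' → g j' * δ (ψ j') n) ≈ g j * δ (ψ j) n
  ∑-δ-collapse {ψ = ψ} {k} ψₖ {n} {j} j≡nₖ g = ∑-unique _ j λ j' j'≢j →
    trans (*-cong refl (𝟙-no (λ n≗ψ → j'≢j (toℕ-injective
                               (≡.trans (≡.sym (ψₖ j')) (≡.trans (≡.sym (n≗ψ k)) (≡.sym j≡nₖ)))))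
                             (n ≟ₘ ψ j')))
          (zeroʳ _)

  actOne-ι : ∀ {N} k (G : Op1 N) p f →
    actOne k G (ι p) f ≈ pairing p (λ n → ∑ (allFin (suc N)) (λ j → G (f k) j * δ (monomialOf (upd f k j)) n))
  actOne-ι {N} k G p f = ∑-coeff (allFin (suc N)) (G (f k)) (λ j → monomialOf (upd f k j)) p

  actTwo-ι : ∀ {N} k k' (G : Op2 N) p f →
    actTwo k k' G (ι p) f ≈ pairing p (λ n → ∑ (allFin (suc N)) (λ j → ∑ (allFin (suc N)) (λ j' →
                              G (f k) (f k') j j' * δ (monomialOf (upd (upd f k j) k' j')) n)))
  actTwo-ι {N} k k' G p f = trans
    (∑-cong (allFin (suc N)) (λ j →
      ∑-coeff (allFin (suc N)) (G (f k) (f k') j) (λ j' → monomialOf (upd (upd f k j) k' j')) p))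
    (sym (pairing-∑ p (allFin (suc N)) _))

  coincideOnH-byKernel : ∀ {N} (F : Matrix N) (T : Tensor N → Tensor N) (K : (Fin N → Fin (suc N)) → Monomial N → A) →
    (∀ p f → T (ι p) f ≈ pairing p (K f)) →
    (∀ f n → deg n ≡ N → K f n ≈ Φcoeff F n (monomialOf f)) →
    CoincideOnH F T
  coincideOnH-byKernel F T K T-ι K≈Φcoeff p p-hom f = begin
    T (ι p) f                                    ≈⟨ T-ι p f ⟩
    pairing p (K f)                              ≈⟨ pairing-congᴬ p-hom (K≈Φcoeff f) ⟩
    pairing p (λ n → Φcoeff F n (monomialOf f)) ≈⟨ pairing-Φ F p _ ⟨
    pairing (Φ F p) (δ (monomialOf f))           ≈⟨ coeff-pairing (Φ F p) _ ⟨
    ι (Φ F p) f                                  ∎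

  module SingleVariable {N} (k : Fin N) (F : Matrix N)
                        (F-local : ∀ i j → ¬ (i ≡ k × j ≡ k) → F i j ≈ idEntry i j) where

    open Local F (_≟ k) F-local

    X^-vanishesOff : ∀ x → VanishesOff (X[ k ]^ x)
    X^-vanishesOff x i = X^-≢ x

    X^≗restrict : ∀ {x n} → x ≡ n k → X[ k ]^ x ≗ restrict n
    X^≗restrict {x} x≡nₖ = restrict-unique (X^-vanishesOff x) λ { i ≡.refl → ≡.trans (X^-≡ k x) x≡nₖ }

    G' : Op1 N
    G' i j = Φcoeff F (X[ k ]^ toℕ j) (X[ k ]^ toℕ i)

    G'-diagonal : Diagonal G'
    G'-diagonal i j i≢j = Φcoeff-deg (X^-vanishesOff (toℕ j))
      (λ degs≡ → i≢j (toℕ-injective (≡.trans (≡.sym (deg-X^ k (toℕ i))) (≡.trans degs≡ (deg-X^ k (toℕ j))))))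

    G'-coincide : CoincideOnH F (actOne k G')
    G'-coincide = coincideOnH-byKernel F (actOne k G') _ (actOne-ι k G') kernel≈Φcoeff
      where
        kernel≈Φcoeff : ∀ f n → deg n ≡ N →
          ∑ (allFin (suc N)) (λ j → G' (f k) j * δ (monomialOf (upd f k j)) n) ≈ Φcoeff F n (monomialOf f)
        kernel≈Φcoeff f n deg≡N = begin
          ∑ (allFin (suc N)) (λ j → G' (f k) j * δ (ψ j) n)
            ≈⟨ ∑-δ-collapse (λ j → ≡.cong toℕ (upd-≡ f k j)) (toℕ-exponentIndex n deg≡N k) (G' (f k)) ⟩
          G' (f k) jₙ * δ (ψ jₙ) n
            ≈⟨ Φcoeff-local′ (X^≗restrict (toℕ-exponentIndex n deg≡N k)) (X^≗restrict ≡.refl) ψ-in ψ-out ⟩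
          Φcoeff F n (monomialOf f) ∎
          where
            ψ : Fin (suc N) → Monomial N
            ψ j = monomialOf (upd f k j)
            jₙ : Fin (suc N)
            jₙ = exponentIndex n deg≡N k
            ψ-in : ∀ i → i ≡ k → ψ jₙ i ≡ n i
            ψ-in i ≡.refl = ≡.trans (≡.cong toℕ (upd-≡ f k jₙ)) (toℕ-exponentIndex n deg≡N k)
            ψ-out : ∀ i → ¬ i ≡ k → ψ jₙ i ≡ monomialOf f i
            ψ-out i i≢k = ≡.cong toℕ (upd-≢ f jₙ i≢k)

  module TwoVariables {N} (k k' : Fin N) (k≢k' : ¬ k ≡ k') (F : Matrix N)
                      (F-local : ∀ i j → ¬ ((i ≡ k ⊎ i ≡ k') × (j ≡ k ⊎ j ≡ k')) → F i j ≈ idEntry i j) where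

    open Local F (λ i → (i ≟ k) ⊎-dec (i ≟ k')) F-local

    X² : ℕ → ℕ → Monomial N
    X² x y = X[ k ]^ x ⊕ X[ k' ]^ y

    X²-vanishesOff : ∀ x y → VanishesOff (X² x y)
    X²-vanishesOff x y i i∉S = ≡.cong₂ _+ℕ_ (X^-≢ x (i∉S ∘ inj₁)) (X^-≢ y (i∉S ∘ inj₂))

    deg-X² : ∀ x y → deg (X² x y) ≡ x +ℕ y
    deg-X² x y = ≡.trans (deg-⊕ (X[ k ]^ x) (X[ k' ]^ y)) (≡.cong₂ _+ℕ_ (deg-X^ k x) (deg-X^ k' y))

    X²≗restrict : ∀ {x y n} → x ≡ n k → y ≡ n k' → X² x y ≗ restrict n
    X²≗restrict {x} {y} x≡nₖ y≡nₖ' = restrict-unique (X²-vanishesOff x y) λ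
      { i (inj₁ ≡.refl) → ≡.trans (≡.cong₂ _+ℕ_ (X^-≡ k x) (X^-≢ y k≢k')) (≡.trans (ℕ.+-identityʳ x) x≡nₖ)
      ; i (inj₂ ≡.refl) → ≡.trans (≡.cong₂ _+ℕ_ (X^-≢ x (k≢k' ∘ ≡.sym)) (X^-≡ k' y)) y≡nₖ' }

    G : Op2 N
    G i i' j j' = Φcoeff F (X² (toℕ j) (toℕ j')) (X² (toℕ i) (toℕ i'))

    G-blockDiagonal : BlockDiagonalS G
    G-blockDiagonal i i' j j' sums≢ = Φcoeff-deg (X²-vanishesOff (toℕ j) (toℕ j'))
      (λ degs≡ → sums≢ (≡.trans (≡.sym (deg-X² (toℕ i) (toℕ i'))) (≡.trans degs≡ (deg-X² (toℕ j) (toℕ j')))))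

    G-coincide : CoincideOnH F (actTwo k k' G)
    G-coincide = coincideOnH-byKernel F (actTwo k k' G) _ (actTwo-ι k k' G) kernel≈Φcoeff
      where
        kernel≈Φcoeff : ∀ f n → deg n ≡ N →
          ∑ (allFin (suc N)) (λ j → ∑ (allFin (suc N)) (λ j' →
            G (f k) (f k') j j' * δ (monomialOf (upd (upd f k j) k' j')) n)) ≈ Φcoeff F n (monomialOf f)
        kernel≈Φcoeff f n deg≡N = begin
          ∑ (allFin (suc N)) (λ j → ∑ (allFin (suc N)) (λ j' → G (f k) (f k') j j' * δ (ψ j j') n))
            ≈⟨ ∑-cong (allFin (suc N)) (λ j → ∑-δ-collapse (λ j' → ≡.cong toℕ (upd-≡ (upd f k j) k' j'))
                 (toℕ-exponentIndex n deg≡N k') (G (f k) (f k') j)) ⟩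
          ∑ (allFin (suc N)) (λ j → G (f k) (f k') j jₙ' * δ (ψ j jₙ') n)
            ≈⟨ ∑-δ-collapse (λ j → ≡.cong toℕ (≡.trans (upd-≢ (upd f k j) jₙ' k≢k') (upd-≡ f k j)))
                 (toℕ-exponentIndex n deg≡N k) (λ j → G (f k) (f k') j jₙ') ⟩
          G (f k) (f k') jₙ jₙ' * δ (ψ jₙ jₙ') n
            ≈⟨ Φcoeff-local′ (X²≗restrict (toℕ-exponentIndex n deg≡N k) (toℕ-exponentIndex n deg≡N k'))
                             (X²≗restrict ≡.refl ≡.refl) ψ-in ψ-out ⟩
          Φcoeff F n (monomialOf f) ∎
          where
            ψ : Fin (suc N) → Fin (suc N) → Monomial N
            ψ j j' = monomialOf (upd (upd f k j) k' j')
            jₙ jₙ' : Fin (suc N)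
            jₙ  = exponentIndex n deg≡N k
            jₙ' = exponentIndex n deg≡N k'
            ψ-in : ∀ i → i ≡ k ⊎ i ≡ k' → ψ jₙ jₙ' i ≡ n i
            ψ-in i (inj₁ ≡.refl) = ≡.trans (≡.cong toℕ (≡.trans (upd-≢ (upd f k jₙ) jₙ' k≢k') (upd-≡ f k jₙ)))
                                           (toℕ-exponentIndex n deg≡N k)
            ψ-in i (inj₂ ≡.refl) = ≡.trans (≡.cong toℕ (upd-≡ (upd f k jₙ) k' jₙ')) (toℕ-exponentIndex n deg≡N k')
            ψ-out : ∀ i → ¬ (i ≡ k ⊎ i ≡ k') → ψ jₙ jₙ' i ≡ monomialOf f i
            ψ-out i i∉S = ≡.cong toℕ (≡.trans (upd-≢ (upd f k jₙ) jₙ' (i∉S ∘ inj₂)) (upd-≢ f jₙ (i∉S ∘ inj₁)))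

mainTheorem4 : ∀ {c ℓ : Level} (R : CommutativeRing c ℓ) → let open Poly R in
    (N : ℕ) → 2 ≤ N →
      ((k : Fin N) (a : Carrier) (F : Matrix N) →
        F k k ≈ a →
        (∀ i j → ¬ (i ≡ k × j ≡ k) → F i j ≈ idEntry i j) →
        Σ (Op1 N) λ G' → Diagonal G' × CoincideOnH F (actOne k G'))
      ×
      ((k k' : Fin N) → toℕ k' ≡ suc (toℕ k) → (a b c d : Carrier) (F : Matrix N) →
        F k k ≈ a → F k k' ≈ b → F k' k ≈ c → F k' k' ≈ d →
        (∀ i j → ¬ ((i ≡ k ⊎ i ≡ k') × (j ≡ k ⊎ j ≡ k')) → F i j ≈ idEntry i j) →
        Σ (Op2 N) λ G → BlockDiagonalS G × CoincideOnH F (actTwo k k' G))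
-- Neither the entries a, b, c, d nor the bound 2 ≤ N is needed: the operators are read off F.
mainTheorem4 R N _ =
  (λ k _ F _ F-local → let open SingleVariable k F F-local in G' , G'-diagonal , G'-coincide) ,
  (λ k k' k'≡1+k _ _ _ _ F _ _ _ _ F-local →
     let open TwoVariables k k' (adjacent⇒distinct k'≡1+k) F F-local in G , G-blockDiagonal , G-coincide)
  where
    open Development R
    adjacent⇒distinct : ∀ {k k' : Fin N} → toℕ k' ≡ suc (toℕ k) → ¬ k ≡ k'
    adjacent⇒distinct k'≡1+k ≡.refl = ℕ.1+n≢n (≡.sym k'≡1+k)
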